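{- The poset $\hat\Pi^2_n$, obtained from $\Pi^2_n$ by adjoining a new maximum element $\hat 1$, is a lattice.
   Context: $\Pi_n$: set partitions of $\{1,\dots,n\}$; $NC_n$: noncrossing set partitions; both ordered so that $\pi\leq\tau$ iff $\tau$ refines $\pi$. $\Pi^2_n$ is the set of triples $(\pi,\rho,\lambda)$ with $\pi\in NC_n$, $\rho\in\Pi_n$, $\lambda$ a bijection from blocks of $\pi$ to blocks of $\rho$ with $|\lambda(B)|=|B|$, ordered by $(\pi,\rho,\lambda)\geq(\pi',\rho',\lambda')$ iff $\pi$ refines $\pi'$, $\rho$ refines $\rho'$, and $\lambda'(\biguplus_iB_i)=\biguplus_i\lambda(B_i)$ whenever $\biguplus_iB_i\in\pi'$ with $B_i\in\pi$. It has a unique minimum. -}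

module Defs where

open import Data.Nat using (ℕ)
open import Data.Fin using (Fin; _<_; _≟_)
open import Data.List using (List; length; filter)
open import Data.List using () renaming (tabulate to tabulateL)
open import Data.Product using (Σ; ∃; _×_; _,_)
open import Data.Empty using (⊥)
open import Data.Unit using (⊤)
open import Relation.Nullary using (¬_)
open import Relation.Binary.PropositionalEquality using (_≡_)
open import Function.Bundles using (_⇔_)

-- A set partition of {0,…,n-1} (= Fin n) is presented by a block-labelling
-- function: i and j lie in the same block iff they get the same label.
-- Blocks are the nonempty fibres.  Different labellings of the same
-- partition are identified by the (pre)order below, so the poset is the
-- quotient of this preorder.
Partition : ℕ → Set
Partition n = Fin n → Fin n

Refines : ∀ {n} → Partition n → Partition n → Set
Refines p q = ∀ i j → p i ≡ p j → q i ≡ q j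

NonCrossing : ∀ {n} → Partition n → Set
NonCrossing {n} p = (a b c d : Fin n) → a < b → b < c → c < d →
  p a ≡ p c → p b ≡ p d → p a ≡ p b

blockSize : ∀ {n} → Partition n → Fin n → ℕ
blockSize {n} p x = length (filter (λ j → p j ≟ x) (tabulateL {n = n} (λ j → j)))

-- An element (π , ρ , λ) of Π²_n.  λ acts on block labels: the block of π
-- with label x (x used by π) is sent to the block of ρ with label lam x.
record Π² (n : ℕ) : Set where
  field
    π   : Partition n
    ρ   : Partition n
    lam : Fin n → Fin n
    π-nc     : NonCrossing π
    lam-into : ∀ i → ∃ λ k → ρ k ≡ lam (π i)
    lam-inj  : ∀ i j → lam (π i) ≡ lam (π j) → π i ≡ π j
    lam-onto : ∀ k → ∃ λ i → lam (π i) ≡ ρ k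
    lam-size : ∀ i → blockSize ρ (lam (π i)) ≡ blockSize π (π i)

open Π²

-- t′ ≤ t   (i.e. t ≥ t′ in the paper):  π refines π′, ρ refines ρ′, and
-- for every block C of π′ (the block of i), λ′(C) equals the union of
-- λ(B) over the blocks B of π contained in C.
_≤²_ : ∀ {n} → Π² n → Π² n → Set
_≤²_ {n} t′ t =
  Refines (π t) (π t′) × Refines (ρ t) (ρ t′) ×
  ((i k : Fin n) →
     (ρ t′ k ≡ lam t′ (π t′ i)) ⇔ (∃ λ j → π t′ j ≡ π t′ i × ρ t k ≡ lam t (π t j)))

data Hat (A : Set) : Set where
  elem : A → Hat A
  top  : Hat A

_≤̂_ : ∀ {n} → Hat (Π² n) → Hat (Π² n) → Set
_ ≤̂ top = ⊤
top ≤̂ elem _ = ⊥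
elem a ≤̂ elem b = a ≤² b

IsJoin : {A : Set} → (A → A → Set) → A → A → A → Set
IsJoin _≤_ x y z = x ≤ z × y ≤ z × (∀ w → x ≤ w → y ≤ w → z ≤ w)

IsMeet : {A : Set} → (A → A → Set) → A → A → A → Set
IsMeet _≤_ x y z = z ≤ x × z ≤ y × (∀ w → w ≤ x → w ≤ y → w ≤ z)

IsLattice : {A : Set} → (A → A → Set) → Set
IsLattice {A} _≤_ = ∀ (x y : A) → (∃ λ z → IsJoin _≤_ x y z) × (∃ λ z → IsMeet _≤_ x y z)

-- A common upper bound of t₁ = (π₁, ρ₁, λ₁) and t₂ = (π₂, ρ₂, λ₂) refines the common
-- refinement of π₁ and π₂ (blocks B₁ ∩ B₂) and that of ρ₁ and ρ₂, and its λ sends the blocks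
-- inside B₁ ∩ B₂ onto λ₁(B₁) ∩ λ₂(B₂).  As λ preserves the size of every union of blocks, a
-- bound exists only if each λ₁(B₁) ∩ λ₂(B₂) has |B₁ ∩ B₂| elements and together they cover
-- {1,…,n}; under these two conditions the map B₁ ∩ B₂ ↦ λ₁(B₁) ∩ λ₂(B₂) on the common
-- refinements is itself in Π²_n and is the join.  So two elements have a join in Π²_n or only
-- 1̂ above them.  Meets always exist: the π of the meet is the finest noncrossing partition
-- coarser than π₁ and π₂ that puts j and j′ together whenever λ₁(B₁(j)) meets λ₂(B₂(j′)),
-- i.e. the intersection of all such partitions (a decidable condition, there being finitely
-- many), and ρ and λ are induced from it.

module Submission where

open import Defs
open Π²
open import Data.Nat as ℕ using (ℕ; zero; suc; _+_; z≤n; s≤s)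
open import Data.Nat.Properties using (+-suc; ≤-refl; <-irrefl; m≤n⇒m<n∨m≡n; m<n⇒m<1+n)
open import Data.Fin using (Fin; zero; suc; toℕ; _≟_)
open import Data.Fin.Properties using (any?; all?; _<?_; toℕ-injective; toℕ<n)
open import Data.List using (List; []; _∷_; length; filter; allFin)
open import Data.List.Properties using (filter-≐; filter-none)
open import Data.List.Relation.Unary.All using (universal)
open import Data.List.Relation.Unary.Any using (here)
open import Data.List.Membership.Propositional using (_∈_)
open import Data.List.Membership.Propositional.Properties using (∈-filter⁺; ∈-filter⁻; ∈-allFin)
open import Data.Product using (∃; _×_; _,_; proj₁; proj₂; <_,_>)
open import Data.Product.Relation.Binary.Pointwise.NonDependent using (×-isDecEquivalence)
open import Data.Empty using (⊥; ⊥-elim)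
open import Data.Unit using (tt)
open import Data.Sum as Sum using (_⊎_; inj₁; inj₂)
open import Function using (_∘_)
open import Level using (0ℓ)
open import Relation.Nullary using (¬_; Dec; yes; no)
open import Relation.Nullary.Decidable using (map′; _×-dec_; _→-dec_)
open import Relation.Unary using (Pred; Decidable; _≐_; _⊆_; _∪_)
open import Relation.Unary.Properties using (_∪?_; ≐-sym; ≐-trans)
open import Relation.Binary using (Rel; IsDecEquivalence)
import Relation.Binary.Construct.On as On
open import Relation.Binary.PropositionalEquality
  using (_≡_; _≗_; refl; sym; trans; cong; cong₂; subst; module ≡-Reasoning)
import Relation.Binary.PropositionalEquality.Properties as ≡
import Data.Vec.Functional as Vector
open import Function.Bundles using (mk⇔; _⇔_)
open Function.Bundles.Equivalence using (to; from)

count : ∀ {n} {P : Pred (Fin n) 0ℓ} → Decidable P → ℕ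
count {n} P? = length (filter P? (allFin n))

module _ {n : ℕ} {P Q : Pred (Fin n) 0ℓ} where

  count-≐ : (P? : Decidable P) (Q? : Decidable Q) → P ≐ Q → count P? ≡ count Q?
  count-≐ P? Q? P≐Q = cong length (filter-≐ P? Q? P≐Q (allFin n))

  count-∪ : (P? : Decidable P) (Q? : Decidable Q) → (∀ i → P i → Q i → ⊥) →
            count (P? ∪? Q?) ≡ count P? + count Q?
  count-∪ P? Q? disjoint = go (allFin n)
    where
    go : ∀ xs → length (filter (P? ∪? Q?) xs) ≡ length (filter P? xs) + length (filter Q? xs)
    go [] = refl
    go (x ∷ xs) with P? x | Q? x
    ... | yes p | yes q = ⊥-elim (disjoint x p q)
    ... | yes _ | no _  = cong suc (go xs)
    ... | no _  | yes _ = trans (cong suc (go xs)) (sym (+-suc _ _))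
    ... | no _  | no _  = go xs

module _ {n : ℕ} {P : Pred (Fin n) 0ℓ} where

  count-∅ : (P? : Decidable P) → (∀ i → ¬ P i) → count P? ≡ 0
  count-∅ P? ¬P = cong length (filter-none P? (universal ¬P (allFin n)))

  P⇒count>0 : (P? : Decidable P) → ∀ {i} → P i → 0 ℕ.< count P?
  P⇒count>0 P? {i} p with filter P? (allFin n) | ∈-filter⁺ P? (∈-allFin i) p
  ... | _ ∷ _ | _ = s≤s z≤n

  count>0⇒∃ : (P? : Decidable P) → 0 ℕ.< count P? → ∃ P
  count>0⇒∃ P? pos with filter P? (allFin n) in eq
  ... | x ∷ _ = x , proj₂ (∈-filter⁻ P? {xs = allFin n} (subst (x ∈_) (sym eq) (here refl)))

headOf : ∀ {A : Set} {x : A} (xs : List A) → x ∈ xs → A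
headOf (y ∷ _) _ = y

headOf-∈ : ∀ {A : Set} {x : A} (xs : List A) (x∈xs : x ∈ xs) → headOf xs x∈xs ∈ xs
headOf-∈ (_ ∷ _) _ = here refl

headOf-cong : ∀ {A : Set} {x y : A} {xs ys : List A} (x∈xs : x ∈ xs) (y∈ys : y ∈ ys) →
              xs ≡ ys → headOf xs x∈xs ≡ headOf ys y∈ys
headOf-cong {xs = _ ∷ _} _ _ refl = refl

module ClassRep {n : ℕ} {_≈_ : Rel (Fin n) 0ℓ} (isDecEquivalence : IsDecEquivalence _≈_) where

  private module E = IsDecEquivalence isDecEquivalence

  classOf : Fin n → List (Fin n)
  classOf i = filter (E._≟ i) (allFin n)

  classRep : Partition n
  classRep i = headOf (classOf i) (∈-filter⁺ (E._≟ i) (∈-allFin i) E.refl)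

  classRep-≈ : ∀ i → classRep i ≈ i
  classRep-≈ i = proj₂ (∈-filter⁻ (E._≟ i) {xs = allFin n} (headOf-∈ (classOf i) _))

  classRep-cong : ∀ {i j} → i ≈ j → classRep i ≡ classRep j
  classRep-cong i≈j = headOf-cong _ _
    (filter-≐ (E._≟ _) (E._≟ _) ((λ x≈i → E.trans x≈i i≈j) , (λ x≈j → E.trans x≈j (E.sym i≈j)))
              (allFin n))

  classRep-injective : ∀ {i j} → classRep i ≡ classRep j → i ≈ j
  classRep-injective {i} {j} eq =
    E.trans (E.sym (classRep-≈ i)) (subst (_≈ j) (sym eq) (classRep-≈ j))

open ClassRep using (classRep; classRep-≈; classRep-cong; classRep-injective)

sameBlocks-isDecEquivalence : ∀ {n} (p q : Partition n) →
                              IsDecEquivalence (λ i j → p i ≡ p j × q i ≡ q j)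
sameBlocks-isDecEquivalence p q = On.isDecEquivalence < p , q >
  (×-isDecEquivalence (≡.isDecEquivalence _≟_) (≡.isDecEquivalence _≟_))

commonRefinement : ∀ {n} → Partition n → Partition n → Partition n
commonRefinement p q = classRep (sameBlocks-isDecEquivalence p q)

module _ {n : ℕ} {p q : Partition n} where

  commonRefinement-≡ : ∀ {i j} → p i ≡ p j → q i ≡ q j →
                       commonRefinement p q i ≡ commonRefinement p q j
  commonRefinement-≡ pij qij = classRep-cong (sameBlocks-isDecEquivalence p q) (pij , qij)

  commonRefinement-≡⁻¹ : ∀ {i j} → commonRefinement p q i ≡ commonRefinement p q j →
                         p i ≡ p j × q i ≡ q j
  commonRefinement-≡⁻¹ = classRep-injective (sameBlocks-isDecEquivalence p q)

  commonRefinement-nonCrossing : NonCrossing p → NonCrossing q → NonCrossing (commonRefinement p q)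
  commonRefinement-nonCrossing p-nc q-nc a b c d a<b b<c c<d ac bd
    with pac , qac ← commonRefinement-≡⁻¹ ac | pbd , qbd ← commonRefinement-≡⁻¹ bd
    = commonRefinement-≡ (p-nc a b c d a<b b<c c<d pac pbd) (q-nc a b c d a<b b<c c<d qac qbd)

refines? : ∀ {n} (p q : Partition n) → Dec (Refines p q)
refines? p q = all? λ i → all? λ j → (p i ≟ p j) →-dec (q i ≟ q j)

nonCrossing? : ∀ {n} (p : Partition n) → Dec (NonCrossing p)
nonCrossing? p = all? λ a → all? λ b → all? λ c → all? λ d →
  (a <? b) →-dec (b <? c) →-dec (c <? d) →-dec (p a ≟ p c) →-dec (p b ≟ p d) →-dec (p a ≟ p b)

∀-fun? : ∀ m {n} {P : Pred (Fin m → Fin n) 0ℓ} →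
         (∀ {f g} → f ≗ g → P f → P g) → Decidable P → Dec (∀ f → P f)
∀-fun? zero resp P? = map′ (λ p f → resp (λ ()) p) (λ ∀P → ∀P _) (P? (λ ()))
∀-fun? (suc m) {n} {P} resp P? =
  map′ (λ ∀P f → resp head∷tail (∀P (Vector.head f) (Vector.tail f)))
       (λ ∀P x f → ∀P (x Vector.∷ f))
       (all? (λ x → ∀-fun? m (λ f≗g → resp (∷-cong x f≗g)) (λ f → P? (x Vector.∷ f))))
  where
  head∷tail : ∀ {f : Fin (suc m) → Fin n} → Vector.head f Vector.∷ Vector.tail f ≗ f
  head∷tail zero = refl
  head∷tail (suc _) = refl
  ∷-cong : ∀ x {f g : Fin m → Fin n} → f ≗ g → x Vector.∷ f ≗ x Vector.∷ g
  ∷-cong x f≗g zero = refl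
  ∷-cong x f≗g (suc i) = f≗g i

module Intersection {n : ℕ} {Admissible : Pred (Partition n) 0ℓ} (admissible? : Decidable Admissible)
                    (Admissible-resp : ∀ {f g} → f ≗ g → Admissible f → Admissible g) where

  Together : Rel (Fin n) 0ℓ
  Together i j = ∀ g → Admissible g → g i ≡ g j

  together? : ∀ i j → Dec (Together i j)
  together? i j = ∀-fun? n resp (λ g → admissible? g →-dec (g i ≟ g j))
    where
    resp : ∀ {f g} → f ≗ g → (Admissible f → f i ≡ f j) → Admissible g → g i ≡ g j
    resp f≗g fij adm = trans (sym (f≗g i)) (trans (fij (Admissible-resp (sym ∘ f≗g) adm)) (f≗g j))

  together-isDecEquivalence : IsDecEquivalence Together
  together-isDecEquivalence = record
    { isEquivalence = record
      { refl = λ _ _ → refl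
      ; sym = λ ij g adm → sym (ij g adm)
      ; trans = λ ij jk g adm → trans (ij g adm) (jk g adm)
      }
    ; _≟_ = together?
    }

  intersection : Partition n
  intersection = classRep together-isDecEquivalence

  intersection-≡ : ∀ {i j} → Together i j → intersection i ≡ intersection j
  intersection-≡ = classRep-cong together-isDecEquivalence

  intersection-≡⁻¹ : ∀ {i j} → intersection i ≡ intersection j → Together i j
  intersection-≡⁻¹ = classRep-injective together-isDecEquivalence

module _ {n : ℕ} (t : Π² n) where

  Image : Pred (Fin n) 0ℓ → Pred (Fin n) 0ℓ
  Image P k = ∃ λ i → P i × ρ t k ≡ lam t (π t i)

  image? : {P : Pred (Fin n) 0ℓ} → Decidable P → Decidable (Image P)
  image? P? k = any? (λ i → P? i ×-dec (ρ t k ≟ lam t (π t i)))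

  Image-≐ : {P Q : Pred (Fin n) 0ℓ} → P ≐ Q → Image P ≐ Image Q
  Image-≐ (P⊆Q , Q⊆P) = (λ (i , p , e) → i , P⊆Q p , e) , (λ (i , q , e) → i , Q⊆P q , e)

  Image-∪ : {P Q : Pred (Fin n) 0ℓ} → Image (P ∪ Q) ≐ Image P ∪ Image Q
  Image-∪ = (λ { (i , inj₁ p , e) → inj₁ (i , p , e) ; (i , inj₂ q , e) → inj₂ (i , q , e) })
          , (λ { (inj₁ (i , p , e)) → i , inj₁ p , e ; (inj₂ (i , q , e)) → i , inj₂ q , e })

  Image-disjoint : {P Q : Pred (Fin n) 0ℓ} → (∀ {i j} → P i → Q j → π t i ≡ π t j → ⊥) →
                   ∀ k → Image P k → Image Q k → ⊥
  Image-disjoint disjoint k (i , p , e) (j , q , f) = disjoint p q (lam-inj t i j (trans (sym e) f))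

  Image-block : ∀ i → (λ k → ρ t k ≡ lam t (π t i)) ≐ Image (λ j → π t j ≡ π t i)
  Image-block i = (λ e → i , refl , e) , (λ (j , πj≡πi , e) → trans e (cong (lam t) πj≡πi))

  Saturated : Pred (Fin n) 0ℓ → Set
  Saturated P = ∀ {i j} → π t i ≡ π t j → P i → P j

  -- |λ(B)| = |B| extended from single blocks to unions of blocks, one label value at a time.
  count-Image : {P : Pred (Fin n) 0ℓ} (P? : Decidable P) → Saturated P → count P? ≡ count (image? P?)
  count-Image {P} P? saturated =
    begin
      count P?                   ≡⟨ count-≐ P? (Below? n) P≐Below ⟩
      count (Below? n)           ≡⟨ count-Below n ⟩
      count (image? (Below? n))  ≡⟨ count-≐ (image? (Below? n)) (image? P?) (Image-≐ (≐-sym P≐Below)) ⟩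
      count (image? P?)          ∎
    where
    open ≡-Reasoning
    Below At : ℕ → Pred (Fin n) 0ℓ
    Below m j = P j × toℕ (π t j) ℕ.< m
    At m j = P j × toℕ (π t j) ≡ m
    Below? : ∀ m → Decidable (Below m)
    Below? m j = P? j ×-dec (toℕ (π t j) ℕ.<? m)
    At? : ∀ m → Decidable (At m)
    At? m j = P? j ×-dec (toℕ (π t j) ℕ.≟ m)

    P≐Below : P ≐ Below n
    P≐Below = (λ p → p , toℕ<n _) , proj₁

    Below-suc : ∀ m → Below (suc m) ≐ Below m ∪ At m
    Below-suc m = (λ { (p , s≤s le) → Sum.map (p ,_) (p ,_) (m≤n⇒m<n∨m≡n le) })
                , (λ { (inj₁ (p , lt)) → p , m<n⇒m<1+n lt ; (inj₂ (p , refl)) → p , ≤-refl })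

    Below-At-disjoint : ∀ m {i j} → Below m i → At m j → π t i ≡ π t j → ⊥
    Below-At-disjoint m (_ , lt) (_ , refl) eq = <-irrefl (cong toℕ eq) lt

    count-At : ∀ m → count (At? m) ≡ count (image? (At? m))
    count-At m with any? (At? m)
    ... | no ¬At = trans (count-∅ (At? m) (λ j a → ¬At (j , a)))
                         (sym (count-∅ (image? (At? m)) (λ k (j , a , _) → ¬At (j , a))))
    ... | yes (i , p , πi≡m) =
      begin
        count (At? m)          ≡⟨ count-≐ (At? m) block? At≐block ⟩
        count block?           ≡⟨ sym (lam-size t i) ⟩
        count lam-block?       ≡⟨ count-≐ lam-block? (image? block?) (Image-block i) ⟩
        count (image? block?)  ≡⟨ count-≐ (image? block?) (image? (At? m)) (Image-≐ (≐-sym At≐block)) ⟩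
        count (image? (At? m)) ∎
      where
      block? : Decidable (λ j → π t j ≡ π t i)
      block? j = π t j ≟ π t i
      lam-block? : Decidable (λ k → ρ t k ≡ lam t (π t i))
      lam-block? k = ρ t k ≟ lam t (π t i)
      At≐block : At m ≐ (λ j → π t j ≡ π t i)
      At≐block = (λ (_ , πj≡m) → toℕ-injective (trans πj≡m (sym πi≡m)))
               , (λ πj≡πi → saturated (sym πj≡πi) p , trans (cong toℕ πj≡πi) πi≡m)

    count-Below : ∀ m → count (Below? m) ≡ count (image? (Below? m))
    count-Below zero = trans (count-∅ (Below? 0) (λ _ ()))
                             (sym (count-∅ (image? (Below? 0)) (λ { _ (_ , (_ , ()) , _) })))
    count-Below (suc m) =
      begin
        count (Below? (suc m))
          ≡⟨ count-≐ (Below? (suc m)) (Below? m ∪? At? m) (Below-suc m) ⟩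
        count (Below? m ∪? At? m)
          ≡⟨ count-∪ (Below? m) (At? m) (λ _ b a → Below-At-disjoint m b a refl) ⟩
        count (Below? m) + count (At? m)
          ≡⟨ cong₂ _+_ (count-Below m) (count-At m) ⟩
        count (image? (Below? m)) + count (image? (At? m))
          ≡⟨ sym (count-∪ (image? (Below? m)) (image? (At? m)) (Image-disjoint (Below-At-disjoint m))) ⟩
        count (image? (Below? m) ∪? image? (At? m))
          ≡⟨ count-≐ (image? (Below? m) ∪? image? (At? m)) (image? (Below? (suc m)))
                     (≐-trans (≐-sym Image-∪) (Image-≐ (≐-sym (Below-suc m)))) ⟩
        count (image? (Below? (suc m)))
          ∎

≤²-lam : ∀ {n} {t′ t : Π² n} → t′ ≤² t →
         ∀ {j k} → ρ t k ≡ lam t (π t j) → ρ t′ k ≡ lam t′ (π t′ j)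
≤²-lam (_ , _ , lam≤) {j} {k} e = from (lam≤ j k) (j , refl , e)

module Join {n : ℕ} (t₁ t₂ : Π² n) where

  Shared : Fin n → Pred (Fin n) 0ℓ
  Shared i k = ρ t₁ k ≡ lam t₁ (π t₁ i) × ρ t₂ k ≡ lam t₂ (π t₂ i)

  shared? : ∀ i → Decidable (Shared i)
  shared? i k = (ρ t₁ k ≟ lam t₁ (π t₁ i)) ×-dec (ρ t₂ k ≟ lam t₂ (π t₂ i))

  Common : Fin n → Pred (Fin n) 0ℓ
  Common i j = π t₁ j ≡ π t₁ i × π t₂ j ≡ π t₂ i

  common? : ∀ i → Decidable (Common i)
  common? i j = (π t₁ j ≟ π t₁ i) ×-dec (π t₂ j ≟ π t₂ i)

  Shared-resp : ∀ {i j k} → Common i j → Shared j k → Shared i k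
  Shared-resp (π₁ji , π₂ji) (e₁ , e₂) =
    trans e₁ (cong (lam t₁) π₁ji) , trans e₂ (cong (lam t₂) π₂ji)

  record Joinable : Set where
    field
      sizes  : ∀ i → count (shared? i) ≡ count (common? i)
      covers : ∀ k → ∃ λ i → Shared i k

  joinable? : Dec Joinable
  joinable? = map′ (λ (sizes , covers) → record { sizes = sizes ; covers = covers })
                   (λ j → Joinable.sizes j , Joinable.covers j)
                   (  all? (λ i → count (shared? i) ℕ.≟ count (common? i))
                    ×-dec all? (λ k → any? (λ i → shared? i k)))

  module UpperBound (t : Π² n) (t₁≤t : t₁ ≤² t) (t₂≤t : t₂ ≤² t) where

    lam₁ : ∀ {j k} → ρ t k ≡ lam t (π t j) → ρ t₁ k ≡ lam t₁ (π t₁ j)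
    lam₁ = ≤²-lam {t′ = t₁} {t} t₁≤t
    lam₂ : ∀ {j k} → ρ t k ≡ lam t (π t j) → ρ t₂ k ≡ lam t₂ (π t₂ j)
    lam₂ = ≤²-lam {t′ = t₂} {t} t₂≤t

    Shared≐Image : ∀ i → Shared i ≐ Image t (Common i)
    Shared≐Image i = toImage , (λ (j , common , e) → Shared-resp common (lam₁ e , lam₂ e))
      where
      toImage : Shared i ⊆ Image t (Common i)
      toImage {k} (e₁ , e₂)
        with j₁ , π₁j₁i , f₁ ← to (proj₂ (proj₂ t₁≤t) i k) e₁
           | j₂ , π₂j₂i , f₂ ← to (proj₂ (proj₂ t₂≤t) i k) e₂
        = j₁ , (π₁j₁i , trans (proj₁ t₂≤t j₁ j₂ (lam-inj t j₁ j₂ (trans (sym f₁) f₂))) π₂j₂i)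
        , f₁

    joinable : Joinable
    joinable = record { sizes = sizes ; covers = covers }
      where
      sizes : ∀ i → count (shared? i) ≡ count (common? i)
      sizes i = trans (count-≐ (shared? i) (image? t (common? i)) (Shared≐Image i))
                      (sym (count-Image t (common? i) λ πij (π₁ , π₂) →
                        trans (sym (proj₁ t₁≤t _ _ πij)) π₁ , trans (sym (proj₁ t₂≤t _ _ πij)) π₂))
      covers : ∀ k → ∃ λ i → Shared i k
      covers k = let (i , e) = lam-onto t k in i , lam₁ (sym e) , lam₂ (sym e)

  module Construction (joinable : Joinable) where

    open Joinable joinable

    πJ ρJ : Partition n
    πJ = commonRefinement (π t₁) (π t₂)
    ρJ = commonRefinement (ρ t₁) (ρ t₂)

    πJ-≈ : ∀ i → Common i (πJ i)
    πJ-≈ = classRep-≈ (sameBlocks-isDecEquivalence (π t₁) (π t₂))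

    πJ-≡⇔Common : ∀ i j → πJ j ≡ πJ i ⇔ Common i j
    πJ-≡⇔Common i j = mk⇔ commonRefinement-≡⁻¹ (λ (π₁ , π₂) → commonRefinement-≡ π₁ π₂)

    shared-nonempty : ∀ i → ∃ (Shared i)
    shared-nonempty i =
      count>0⇒∃ (shared? i) (subst (0 ℕ.<_) (sym (sizes i)) (P⇒count>0 (common? i) (refl , refl)))

    -- Labels of πJ are positions (class representatives), so lamJ may treat them as such.
    target : Fin n → Fin n
    target x = proj₁ (shared-nonempty x)

    target-shared : ∀ i → Shared i (target (πJ i))
    target-shared i = Shared-resp (πJ-≈ i) (proj₂ (shared-nonempty (πJ i)))

    lamJ : Fin n → Fin n
    lamJ x = ρJ (target x)

    ρJ-≡⇔Shared : ∀ i k → ρJ k ≡ lamJ (πJ i) ⇔ Shared i k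
    ρJ-≡⇔Shared i k = mk⇔
      (λ e → let (ρ₁ , ρ₂) = commonRefinement-≡⁻¹ e ; (s₁ , s₂) = target-shared i in
             trans ρ₁ s₁ , trans ρ₂ s₂)
      (λ (s₁ , s₂) → let (s₁′ , s₂′) = target-shared i in
                     commonRefinement-≡ (trans s₁ (sym s₁′)) (trans s₂ (sym s₂′)))

    J : Π² n
    π J = πJ
    ρ J = ρJ
    lam J = lamJ
    π-nc J = commonRefinement-nonCrossing (π-nc t₁) (π-nc t₂)
    lam-into J i = target (πJ i) , refl
    lam-inj J i j e =
      let (s₁ , s₂) = target-shared i ; (s₁′ , s₂′) = to (ρJ-≡⇔Shared j (target (πJ i))) e in
      commonRefinement-≡ (lam-inj t₁ i j (trans (sym s₁) s₁′)) (lam-inj t₂ i j (trans (sym s₂) s₂′))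
    lam-onto J k = let (i , s) = covers k in i , sym (from (ρJ-≡⇔Shared i k) s)
    lam-size J i =
      begin
        count lam-block?
          ≡⟨ count-≐ lam-block? (shared? i) (to (ρJ-≡⇔Shared i _) , from (ρJ-≡⇔Shared i _)) ⟩
        count (shared? i)
          ≡⟨ sizes i ⟩
        count (common? i)
          ≡⟨ count-≐ (common? i) block? (from (πJ-≡⇔Common i _) , to (πJ-≡⇔Common i _)) ⟩
        count block?
          ∎
      where
      open ≡-Reasoning
      block? : Decidable (λ j → πJ j ≡ πJ i)
      block? j = πJ j ≟ πJ i
      lam-block? : Decidable (λ k → ρJ k ≡ lamJ (πJ i))
      lam-block? k = ρJ k ≟ lamJ (πJ i)

    ≤²-J : (t : Π² n) → Refines πJ (π t) → Refines ρJ (ρ t) →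
           (∀ {i k} → Shared i k → ρ t k ≡ lam t (π t i)) → t ≤² J
    ≤²-J t πJ⊑πt ρJ⊑ρt shared⇒ = πJ⊑πt , ρJ⊑ρt , λ i k → mk⇔
      (λ e → let (j , s) = covers k in
             j , lam-inj t j i (trans (sym (shared⇒ s)) e) , from (ρJ-≡⇔Shared j k) s)
      (λ (j , πtj≡πti , e) → trans (shared⇒ (to (ρJ-≡⇔Shared j k) e)) (cong (lam t) πtj≡πti))

    t₁≤J : t₁ ≤² J
    t₁≤J = ≤²-J t₁ (λ _ _ → proj₁ ∘ commonRefinement-≡⁻¹) (λ _ _ → proj₁ ∘ commonRefinement-≡⁻¹)
                proj₁

    t₂≤J : t₂ ≤² J
    t₂≤J = ≤²-J t₂ (λ _ _ → proj₂ ∘ commonRefinement-≡⁻¹) (λ _ _ → proj₂ ∘ commonRefinement-≡⁻¹)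
                proj₂

    J-least : ∀ t → t₁ ≤² t → t₂ ≤² t → J ≤² t
    J-least t t₁≤t t₂≤t =
      (λ i j e → commonRefinement-≡ {p = π t₁} {q = π t₂} (proj₁ t₁≤t i j e) (proj₁ t₂≤t i j e)) ,
      (λ k k′ e → commonRefinement-≡ {p = ρ t₁} {q = ρ t₂}
                    (proj₁ (proj₂ t₁≤t) k k′ e) (proj₁ (proj₂ t₂≤t) k k′ e)) ,
      λ i k → mk⇔ (fwd i k) (bwd i k)
      where
      open UpperBound t t₁≤t t₂≤t
      fwd : ∀ i k → ρJ k ≡ lamJ (πJ i) → ∃ λ j → πJ j ≡ πJ i × ρ t k ≡ lam t (π t j)
      fwd i k e = let (j , c , f) = proj₁ (Shared≐Image i) (to (ρJ-≡⇔Shared i k) e) in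
                  j , from (πJ-≡⇔Common i j) c , f
      bwd : ∀ i k → (∃ λ j → πJ j ≡ πJ i × ρ t k ≡ lam t (π t j)) → ρJ k ≡ lamJ (πJ i)
      bwd i k (j , πJj≡πJi , f) = from (ρJ-≡⇔Shared i k)
        (proj₂ (Shared≐Image i) (j , to (πJ-≡⇔Common i j) πJj≡πJi , f))

    J-isJoin : IsJoin _≤²_ t₁ t₂ J
    J-isJoin = t₁≤J , t₂≤J , J-least

  join-or-unbounded : (∃ λ z → IsJoin _≤²_ t₁ t₂ z) ⊎ (∀ t → t₁ ≤² t → t₂ ≤² t → ⊥)
  join-or-unbounded with joinable?
  ... | yes j = inj₁ (Construction.J j , Construction.J-isJoin j)
  ... | no ¬j = inj₂ (λ t t₁≤t t₂≤t → ¬j (UpperBound.joinable t t₁≤t t₂≤t))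

module Meet {n : ℕ} (t₁ t₂ : Π² n) where

  Compatible : Partition n → Set
  Compatible g = ∀ j j′ k → ρ t₁ k ≡ lam t₁ (π t₁ j) → ρ t₂ k ≡ lam t₂ (π t₂ j′) → g j ≡ g j′

  -- What the π-component of every common lower bound of t₁ and t₂ satisfies;
  -- the finest such partition is the π-component of the meet.
  record Admissible (g : Partition n) : Set where
    field
      nonCrossing : NonCrossing g
      refines₁    : Refines (π t₁) g
      refines₂    : Refines (π t₂) g
      compatible  : Compatible g

  compatible? : ∀ g → Dec (Compatible g)
  compatible? g = all? λ j → all? λ j′ → all? λ k →
    (ρ t₁ k ≟ lam t₁ (π t₁ j)) →-dec (ρ t₂ k ≟ lam t₂ (π t₂ j′)) →-dec (g j ≟ g j′)

  admissible? : Decidable Admissible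
  admissible? g =
    map′ (λ (nc , r₁ , r₂ , c) →
            record { nonCrossing = nc ; refines₁ = r₁ ; refines₂ = r₂ ; compatible = c })
         (λ adm → let open Admissible adm in nonCrossing , refines₁ , refines₂ , compatible)
         (nonCrossing? g ×-dec refines? (π t₁) g ×-dec refines? (π t₂) g ×-dec compatible? g)

  Admissible-resp : ∀ {f g} → f ≗ g → Admissible f → Admissible g
  Admissible-resp {f} {g} f≗g adm = record
    { nonCrossing = λ a b c d a<b b<c c<d ac bd →
        to≗ (nonCrossing a b c d a<b b<c c<d (from≗ ac) (from≗ bd))
    ; refines₁ = λ i j e → to≗ (refines₁ i j e)
    ; refines₂ = λ i j e → to≗ (refines₂ i j e)
    ; compatible = λ j j′ k e e′ → to≗ (compatible j j′ k e e′)
    }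
    where
    open Admissible adm
    to≗ : ∀ {i j} → f i ≡ f j → g i ≡ g j
    to≗ {i} {j} e = trans (sym (f≗g i)) (trans e (f≗g j))
    from≗ : ∀ {i j} → g i ≡ g j → f i ≡ f j
    from≗ {i} {j} e = trans (f≗g i) (trans e (sym (f≗g j)))

  open Intersection admissible? Admissible-resp using (intersection; intersection-≡; intersection-≡⁻¹)

  πM : Partition n
  πM = intersection

  πM-admissible : Admissible πM
  πM-admissible = record
    { nonCrossing = λ a b c d a<b b<c c<d ac bd → intersection-≡ λ g adm →
        Admissible.nonCrossing adm a b c d a<b b<c c<d
          (intersection-≡⁻¹ ac g adm) (intersection-≡⁻¹ bd g adm)
    ; refines₁ = λ i j e → intersection-≡ λ g adm → Admissible.refines₁ adm i j e
    ; refines₂ = λ i j e → intersection-≡ λ g adm → Admissible.refines₂ adm i j e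
    ; compatible = λ j j′ k e e′ → intersection-≡ λ g adm → Admissible.compatible adm j j′ k e e′
    }

  open Admissible πM-admissible renaming (refines₁ to πM-refines₁; refines₂ to πM-refines₂)

  preimage₁ : Fin n → Fin n
  preimage₁ k = proj₁ (lam-onto t₁ k)

  lam-preimage₁ : ∀ k → ρ t₁ k ≡ lam t₁ (π t₁ (preimage₁ k))
  lam-preimage₁ k = sym (proj₂ (lam-onto t₁ k))

  -- ρM is read off through t₁; compatibility makes t₂ give the same answer (ρM-lam₂).
  ρM : Partition n
  ρM k = πM (preimage₁ k)

  ρM-lam₁ : ∀ {j k} → ρ t₁ k ≡ lam t₁ (π t₁ j) → ρM k ≡ πM j
  ρM-lam₁ {j} {k} e =
    πM-refines₁ (preimage₁ k) j (lam-inj t₁ (preimage₁ k) j (trans (sym (lam-preimage₁ k)) e))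

  ρM-lam₂ : ∀ {j k} → ρ t₂ k ≡ lam t₂ (π t₂ j) → ρM k ≡ πM j
  ρM-lam₂ {j} {k} e = compatible (preimage₁ k) j k (lam-preimage₁ k) e

  ρM-≐Image : (t : Π² n) → (∀ {j k} → ρ t k ≡ lam t (π t j) → ρM k ≡ πM j) →
              ∀ i → (λ k → ρM k ≡ πM i) ≐ Image t (λ j → πM j ≡ πM i)
  ρM-≐Image t ρM-lam i =
    (λ {k} e → let (j , λj≡ρk) = lam-onto t k in j , trans (sym (ρM-lam (sym λj≡ρk))) e , sym λj≡ρk) ,
    (λ (j , πMj≡πMi , e) → trans (ρM-lam e) πMj≡πMi)

  M : Π² n
  π M = πM
  ρ M = ρM
  lam M x = x
  π-nc M = nonCrossing
  lam-into M i = let (k , e) = lam-into t₁ i in k , ρM-lam₁ e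
  lam-inj M i j e = e
  lam-onto M k = preimage₁ k , refl
  lam-size M i =
    begin
      count lam-block?            ≡⟨ count-≐ lam-block? (image? t₁ block?) (ρM-≐Image t₁ ρM-lam₁ i) ⟩
      count (image? t₁ block?)    ≡⟨ sym (count-Image t₁ block? (λ e → trans (sym (πM-refines₁ _ _ e)))) ⟩
      count block?                ∎
    where
    open ≡-Reasoning
    block? : Decidable (λ j → πM j ≡ πM i)
    block? j = πM j ≟ πM i
    lam-block? : Decidable (λ k → ρM k ≡ πM i)
    lam-block? k = ρM k ≟ πM i

  M≤ : (t : Π² n) (ρM-lam : ∀ {j k} → ρ t k ≡ lam t (π t j) → ρM k ≡ πM j) →
       Refines (π t) πM → M ≤² t
  M≤ t ρM-lam πt⊑πM =
    πt⊑πM , ρt⊑ρM , λ i k → mk⇔ (proj₁ (ρM-≐Image t ρM-lam i)) (proj₂ (ρM-≐Image t ρM-lam i))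
    where
    ρt⊑ρM : Refines (ρ t) ρM
    ρt⊑ρM k k′ e = let (j , λj≡ρk′) = lam-onto t k′ in
      trans (ρM-lam (trans e (sym λj≡ρk′))) (sym (ρM-lam (sym λj≡ρk′)))

  M-greatest : ∀ t′ → t′ ≤² t₁ → t′ ≤² t₂ → t′ ≤² M
  M-greatest t′ t′≤t₁ t′≤t₂ = πM⊑π′ , ρM⊑ρ′ , λ i k → mk⇔ (fwd i k) (bwd i k)
    where
    lam₁ : ∀ {j k} → ρ t₁ k ≡ lam t₁ (π t₁ j) → ρ t′ k ≡ lam t′ (π t′ j)
    lam₁ = ≤²-lam {t′ = t′} {t₁} t′≤t₁
    lam₂ : ∀ {j k} → ρ t₂ k ≡ lam t₂ (π t₂ j) → ρ t′ k ≡ lam t′ (π t′ j)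
    lam₂ = ≤²-lam {t′ = t′} {t₂} t′≤t₂
    π′-admissible : Admissible (π t′)
    π′-admissible = record
      { nonCrossing = π-nc t′
      ; refines₁ = proj₁ t′≤t₁
      ; refines₂ = proj₁ t′≤t₂
      ; compatible = λ j j′ k e e′ → lam-inj t′ j j′ (trans (sym (lam₁ e)) (lam₂ e′))
      }
    πM⊑π′ : Refines πM (π t′)
    πM⊑π′ i j e = intersection-≡⁻¹ e (π t′) π′-admissible
    ρ′-lam : ∀ k → ρ t′ k ≡ lam t′ (π t′ (preimage₁ k))
    ρ′-lam k = lam₁ (lam-preimage₁ k)
    ρM⊑ρ′ : Refines ρM (ρ t′)
    ρM⊑ρ′ k k′ e = trans (ρ′-lam k) (trans (cong (lam t′) (πM⊑π′ _ _ e)) (sym (ρ′-lam k′)))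
    fwd : ∀ i k → ρ t′ k ≡ lam t′ (π t′ i) → ∃ λ j → π t′ j ≡ π t′ i × ρM k ≡ πM j
    fwd i k e = preimage₁ k , lam-inj t′ (preimage₁ k) i (trans (sym (ρ′-lam k)) e) , refl
    bwd : ∀ i k → (∃ λ j → π t′ j ≡ π t′ i × ρM k ≡ πM j) → ρ t′ k ≡ lam t′ (π t′ i)
    bwd i k (j , π′j≡π′i , e) = trans (ρ′-lam k) (cong (lam t′) (trans (πM⊑π′ _ _ e) π′j≡π′i))

  M-isMeet : IsMeet _≤²_ t₁ t₂ M
  M-isMeet = M≤ t₁ ρM-lam₁ πM-refines₁ , M≤ t₂ ρM-lam₂ πM-refines₂ , M-greatest

≤²-refl : ∀ {n} (t : Π² n) → t ≤² t
≤²-refl t = (λ _ _ e → e) , (λ _ _ e → e) ,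
  λ i k → mk⇔ (λ e → i , refl , e) (λ (j , πj≡πi , e) → trans e (cong (lam t) πj≡πi))

module _ {n : ℕ} where

  ≤̂-refl : (x : Hat (Π² n)) → x ≤̂ x
  ≤̂-refl top = tt
  ≤̂-refl (elem t) = ≤²-refl t

  top-isJoinˡ : (y : Hat (Π² n)) → IsJoin _≤̂_ top y top
  top-isJoinˡ _ = tt , tt , λ _ top≤w _ → top≤w

  top-isJoinʳ : (x : Hat (Π² n)) → IsJoin _≤̂_ x top top
  top-isJoinʳ _ = tt , tt , λ _ _ top≤w → top≤w

  top-isMeetˡ : (y : Hat (Π² n)) → IsMeet _≤̂_ top y y
  top-isMeetˡ y = tt , ≤̂-refl y , λ _ _ w≤y → w≤y

  top-isMeetʳ : (x : Hat (Π² n)) → IsMeet _≤̂_ x top x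
  top-isMeetʳ x = ≤̂-refl x , tt , λ _ w≤x _ → w≤x

  join-or-top : ∀ {a b : Π² n} →
                (∃ λ z → IsJoin _≤²_ a b z) ⊎ (∀ t → a ≤² t → b ≤² t → ⊥) →
                ∃ λ z → IsJoin _≤̂_ (elem a) (elem b) z
  join-or-top (inj₁ (z , a≤z , b≤z , least)) =
    elem z , a≤z , b≤z , λ { top _ _ → tt ; (elem w) → least w }
  join-or-top (inj₂ unbounded) =
    top , tt , tt , λ { top _ _ → tt ; (elem t) a≤t b≤t → ⊥-elim (unbounded t a≤t b≤t) }

  elem-isMeet : ∀ {a b z : Π² n} → IsMeet _≤²_ a b z → IsMeet _≤̂_ (elem a) (elem b) (elem z)
  elem-isMeet (z≤a , z≤b , greatest) = z≤a , z≤b , λ { top () _ ; (elem w) → greatest w }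

proposition8 : (n : ℕ) → IsLattice (_≤̂_ {n})
proposition8 n top y = (top , top-isJoinˡ y) , (y , top-isMeetˡ y)
proposition8 n (elem a) top = (top , top-isJoinʳ (elem a)) , (elem a , top-isMeetʳ (elem a))
proposition8 n (elem a) (elem b) =
  join-or-top (Join.join-or-unbounded a b) , (elem (Meet.M a b) , elem-isMeet (Meet.M-isMeet a b))
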